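{- Let $A=\{a_n\}$ and $B=\{b_n\}$ be infinite sets of natural numbers (enumerated increasingly) such that $\sum_{n=1}^\infty\frac{1}{a_n}=\infty$ and $\log b_n=o(n^\varepsilon)$ for every $\varepsilon>0$. Then for every $h\ge2$ and every $k\ge1$ there exist infinitely many $h$-element sets $\{\beta_1<\ldots<\beta_h\}\subseteq B$ such that for all $1\le i<j\le h$, the distance $\beta_j-\beta_i$ equals the distance of at least $k$ pairs of elements of $A$, i.e. $|A\cap(A+(\beta_j-\beta_i))|\ge k$.
   Context: Natural numbers are positive integers; $A+x=\{a+x\mid a\in A\}$; $c_n=o(g(n))$ means $c_n/g(n)\to0$. -}

module Defs where

open import Data.Nat using (ℕ; zero; suc; _+_; _*_; _^_; _≤_; _<_; _∸_)
open import Data.Nat.Logarithm using (⌊log₂_⌋)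
open import Data.Integer using (+_)
open import Data.Rational as ℚ using (ℚ)
open import Data.Fin using (Fin)
open import Data.Product using (Σ; ∃; _×_)
open import Relation.Binary.PropositionalEquality using (_≡_)
open import Function.Definitions using (Injective)

-- A set of natural numbers (positive integers) given by its increasing enumeration
-- a 0 < a 1 < a 2 < ... , all ≥ 1 (index 0 plays the role of n = 1).
IncEnum : (ℕ → ℕ) → Set
IncEnum a = (1 ≤ a 0) × (∀ n → a n < a (suc n))

_∈ₛ_ : ℕ → (ℕ → ℕ) → Set
x ∈ₛ a = ∃ λ n → a n ≡ x

-- reciprocal 1/m as a rational (1/0 := 0, never used since elements are ≥ 1)
recip : ℕ → ℚ
recip zero = ℚ.0ℚ
recip (suc m) = (+ 1) ℚ./ suc m

partialRecipSum : (ℕ → ℕ) → ℕ → ℚ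
partialRecipSum a zero = ℚ.0ℚ
partialRecipSum a (suc N) = partialRecipSum a N ℚ.+ recip (a N)

RecipSumDiverges : (ℕ → ℕ) → Set
RecipSumDiverges a = ∀ (M : ℚ) → ∃ λ N → M ℚ.≤ partialRecipSum a N

-- log b_n = o(n^ε) for every ε > 0.  Rendered as: for every
-- q ≥ 1 (ε = 1/q) and every m ≥ 1 (δ = 1/m), eventually
--   log b_n ≤ δ · n^(1/q),  i.e.  (m · log b_n)^q ≤ n,
-- with log taken as ⌊log₂⌋ (base and floor do not affect the o(n^ε) condition).
-- The paper index n ≥ 1 corresponds to index n-1 here, hence "suc n".
LogSubPoly : (ℕ → ℕ) → Set
LogSubPoly b = ∀ (q m : ℕ) → 1 ≤ q → 1 ≤ m →
  ∃ λ N → ∀ n → N ≤ n → (m * ⌊log₂ b n ⌋) ^ q ≤ suc n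

AtLeast : ℕ → (ℕ → Set) → Set
AtLeast k P = Σ (Fin k → ℕ) λ f → Injective _≡_ _≡_ f × (∀ i → P (f i))

ManyReps : (ℕ → ℕ) → ℕ → ℕ → Set
ManyReps a k d = AtLeast k (λ z → z ∈ₛ a × ∃ λ y → y ∈ₛ a × z ≡ y + d)

-- Divergence of ∑ 1/aₙ forces infinitely many dyadic scales j at which A is dense,
-- a(2^j) < 2^j (j+1)(j+2): otherwise each dyadic block [2^J, 2^{J+1}) would contribute at
-- most 1/(J+1) − 1/(J+2) and the series would telescope to a finite sum.  At such a scale
-- let s = 2^j, Aₛ = {a₀, …, a_{s−1}} and M = a(s) + s ≤ 8j²(s − k).  Since log bₙ = o(n^ε),
-- the m = h(8j²)^k consecutive elements gᵢ = b(m₀ + i) are all below s, so the translates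
-- Aₛ + gᵢ lie in [0, M).  Choosing k points of [0, M) one at a time, each lying in as many
-- surviving translates as possible, keeps at least m((s − k)/M)^k > h − 1 translates that
-- contain all chosen points x₁, …, x_k.  For two of them, g < g′, the k numbers x_v − g lie
-- in A and so do x_v − g − (g′ − g): the difference g′ − g has k representations.  Taking
-- m₀ beyond the first entries of the excluded tuples makes the new tuple a fresh one.

{-# OPTIONS --safe #-}
module Submission where

open import Defs
open import Data.Fin as Fin using (Fin; toℕ) renaming (zero to fzero; suc to fsuc)
import Data.Fin.Properties as Finₚ
open import Data.Integer.Base as ℤ using (+≤+)
import Data.Integer.Properties as ℤₚ
open import Data.List as List using (List)
open import Data.List.Extrema.Nat using (max; xs≤max)
open import Data.List.Membership.Propositional using (_∉_)
import Data.List.Relation.Unary.All as ListAll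
import Data.List.Relation.Unary.All.Properties as ListAllₚ
open import Data.Nat
open import Data.Nat.Logarithm using (⌊log₂_⌋; ⌊log₂⌋-mono-≤; ⌊log₂[2^n]⌋≡n)
open import Data.Nat.Properties
open import Algebra.Properties.CommutativeSemigroup *-commutativeSemigroup
  using (interchange; x∙yz≈y∙xz; x∙yz≈y∙zx; x∙yz≈yx∙z)
open import Algebra.Properties.Semiring.Sum +-*-semiring
  using (sum; sum-syntax; ∑-comm; *-distribˡ-sum; *-distribʳ-sum; ∑-distrib-+; sum-cong-≗)
open import Data.Nat.Tactic.RingSolver using (solve-∀)
open import Data.Product using (Σ; ∃; _×_; _,_; proj₁; proj₂)
open import Data.Rational.Base using (toℚᵘ; fromℚᵘ)
import Data.Rational.Properties as ℚₚ
open import Data.Rational.Unnormalised.Base using (ℚᵘ; *≤*)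
  renaming (_/_ to _/ᵘ_; _≤_ to _≤ᵘ_; _+_ to _+ᵘ_; _≃_ to _≃ᵘ_; 0ℚᵘ to 0ᵘ)
import Data.Rational.Unnormalised.Properties as ℚᵘₚ
open import Data.Sum using (inj₁; inj₂)
open import Data.Vec using (Vec; []; _∷_; lookup; head; tabulate)
open import Data.Vec.Properties using (lookup∘tabulate)
open import Data.Vec.Relation.Unary.All as All using (All; []; _∷_)
open import Data.Vec.Relation.Unary.All.Properties using (lookup⁺)
open import Data.Vec.Relation.Unary.AllPairs using ([]; _∷_)
open import Data.Vec.Relation.Unary.Unique.Propositional using (Unique)
open import Data.Vec.Relation.Unary.Unique.Propositional.Properties using (lookup-injective)
open import Function using (_∘_)
open import Function.Definitions using (Injective)
open import Relation.Binary.Core using (_Preserves_⟶_)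
open import Relation.Binary.Definitions using (tri<; tri≈; tri>)
open import Relation.Binary.PropositionalEquality
open import Relation.Nullary using (¬_; Dec; yes; no; contradiction)

n<2^n : ∀ n → n < 2 ^ n
n<2^n zero    = s≤s z≤n
n<2^n (suc n) = +-mono-≤ (m^n>0 2 n) (≤-trans (n<2^n n) (m≤m+n (2 ^ n) 0))

<-step⇒<-mono : ∀ {f : ℕ → ℕ} → (∀ n → f n < f (suc n)) → ∀ {m n} → m < n → f m < f n
<-step⇒<-mono f-step {m} {suc n} m<1+n with m≤n⇒m<n∨m≡n (s≤s⁻¹ m<1+n)
... | inj₁ m<n  = <-trans (<-step⇒<-mono f-step m<n) (f-step n)
... | inj₂ refl = f-step m

<-step⇒≤-mono : ∀ {f : ℕ → ℕ} → (∀ n → f n < f (suc n)) → ∀ {m n} → m ≤ n → f m ≤ f n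
<-step⇒≤-mono f-step m≤n with m≤n⇒m<n∨m≡n m≤n
... | inj₁ m<n  = <⇒≤ (<-step⇒<-mono f-step m<n)
... | inj₂ refl = ≤-refl

n<enum : ∀ {a} → IncEnum a → ∀ n → n < a n
n<enum (1≤a₀ , _)     zero    = 1≤a₀
n<enum inc@(_ , step) (suc n) = <-≤-trans (s≤s (n<enum inc n)) (step n)

1≤m*n⇒1≤m : ∀ m {n} → 1 ≤ m * n → 1 ≤ m
1≤m*n⇒1≤m (suc m) _ = s≤s z≤n

1≤m*n⇒1≤n : ∀ m {n} → 1 ≤ m * n → 1 ≤ n
1≤m*n⇒1≤n m {suc n} _ = s≤s z≤n
1≤m*n⇒1≤n m {zero}  p = contradiction (subst (1 ≤_) (*-zeroʳ m) p) λ ()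

n≤[1∸m]*n+m*n : ∀ m n → n ≤ (1 ∸ m) * n + m * n
n≤[1∸m]*n+m*n zero    n = ≤-reflexive (sym (trans (+-identityʳ _) (+-identityʳ n)))
n≤[1∸m]*n+m*n (suc m) n rewrite 0∸n≡0 m = m≤m+n n (m * n)

1≤[1∸m]*n⇒m≡0 : ∀ m n → 1 ≤ (1 ∸ m) * n → m ≡ 0
1≤[1∸m]*n⇒m≡0 zero    n _ = refl
1≤[1∸m]*n⇒m≡0 (suc m) n p rewrite 0∸n≡0 m = contradiction p λ ()

^-distribʳ-* : ∀ m n k → (m * n) ^ k ≡ m ^ k * n ^ k
^-distribʳ-* m n zero    = refl
^-distribʳ-* m n (suc k) = trans (cong (m * n *_) (^-distribʳ-* m n k)) (interchange m n (m ^ k) (n ^ k))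

m≤m^[1+n] : ∀ m n → m ≤ m ^ suc n
m≤m^[1+n] zero      n = z≤n
m≤m^[1+n] m@(suc _) n = m≤m*n m (m ^ n) {{m^n≢0 m n}}

sum-mono-≤ : ∀ {n} {f g : Fin n → ℕ} → (∀ i → f i ≤ g i) → sum f ≤ sum g
sum-mono-≤ {zero}  f≤g = z≤n
sum-mono-≤ {suc n} f≤g = +-mono-≤ (f≤g fzero) (sum-mono-≤ (f≤g ∘ fsuc))

sum-const : ∀ n c → ∑[ i < n ] c ≡ n * c
sum-const zero    c = refl
sum-const (suc n) c = cong (c +_) (sum-const n c)

sum-zero : ∀ n → ∑[ i < n ] 0 ≡ 0
sum-zero n = trans (sum-const n 0) (*-zeroʳ n)

aboveAverage : ∀ {n} (f : Fin n → ℕ) → 1 ≤ sum f → ∃ λ i → sum f ≤ n * f i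
aboveAverage {suc n} f _ = maximal f
  where
  maximal : ∀ {n} (f : Fin (suc n) → ℕ) → ∃ λ i → sum f ≤ suc n * f i
  maximal {zero}  f = fzero , ≤-refl
  maximal {suc n} f with maximal (f ∘ fsuc)
  ... | i , ≤fi with f fzero ≤? f (fsuc i)
  ...   | yes f₀≤fi = fsuc i , +-mono-≤ f₀≤fi ≤fi
  ...   | no  f₀≰fi = fzero , +-monoʳ-≤ (f fzero) (≤-trans ≤fi (*-monoʳ-≤ (suc n) (<⇒≤ (≰⇒> f₀≰fi))))

selectIncreasing : ∀ {m h} (w : Fin m → ℕ) → (∀ i → w i ≤ 1) → h ≤ sum w →
  Σ (Fin h → Fin m) λ ι → ι Preserves Fin._<_ ⟶ Fin._<_ × (∀ t → 1 ≤ w (ι t))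
selectIncreasing {h = zero} w w≤1 _ = (λ ()) , (λ { {()} }) , (λ ())
selectIncreasing {suc m} {suc h} w w≤1 h≤sum with w fzero in w₀
... | zero with selectIncreasing (w ∘ fsuc) (w≤1 ∘ fsuc) h≤sum
...   | ι , ι-mono , ι-pos = fsuc ∘ ι , s≤s ∘ ι-mono , ι-pos
selectIncreasing {suc m} {suc h} w w≤1 (s≤s h≤sum) | suc zero
  with selectIncreasing (w ∘ fsuc) (w≤1 ∘ fsuc) h≤sum
...   | ι , ι-mono , ι-pos = ι′ , ι′-mono , ι′-pos
  where
  ι′ : Fin (suc h) → Fin (suc m)
  ι′ fzero    = fzero
  ι′ (fsuc t) = fsuc (ι t)
  ι′-mono : ι′ Preserves Fin._<_ ⟶ Fin._<_
  ι′-mono {fzero}  {fsuc _} _         = s≤s z≤n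
  ι′-mono {fsuc _} {fsuc _} (s≤s t<u) = s≤s (ι-mono t<u)
  ι′-pos : ∀ t → 1 ≤ w (ι′ t)
  ι′-pos fzero    = ≤-reflexive (sym w₀)
  ι′-pos (fsuc t) = ι-pos t
selectIncreasing {suc m} {suc h} w w≤1 _ | suc (suc _) =
  contradiction (subst (_≤ 1) w₀ (w≤1 fzero)) λ { (s≤s ()) }

δ : ℕ → ℕ → ℕ
δ zero    zero    = 1
δ zero    (suc _) = 0
δ (suc _) zero    = 0
δ (suc x) (suc y) = δ x y

δ-refl : ∀ x → δ x x ≡ 1
δ-refl zero    = refl
δ-refl (suc x) = δ-refl x

≢⇒δ≡0 : ∀ {x y} → x ≢ y → δ x y ≡ 0
≢⇒δ≡0 {zero}  {zero}  x≢y = contradiction refl x≢y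
≢⇒δ≡0 {zero}  {suc _} _   = refl
≢⇒δ≡0 {suc _} {zero}  _   = refl
≢⇒δ≡0 {suc x} {suc y} x≢y = ≢⇒δ≡0 (x≢y ∘ cong suc)

∑δ≡1 : ∀ {M} c → c < M → ∑[ x < M ] δ c (toℕ x) ≡ 1
∑δ≡1 {suc M} zero    _         = cong suc (sum-zero M)
∑δ≡1 {suc M} (suc c) (s≤s c<M) = ∑δ≡1 c c<M

∑δ*≤ : ∀ {M} c (F : ℕ → ℕ) → ∑[ x < M ] (δ c (toℕ x) * F (toℕ x)) ≤ F c
∑δ*≤ {zero}  c       F = z≤n
∑δ*≤ {suc M} zero    F = ≤-reflexive (trans (cong₂ _+_ (+-identityʳ (F 0)) (sum-zero M)) (+-identityʳ (F 0)))
∑δ*≤ {suc M} (suc c) F = ∑δ*≤ {M} c (F ∘ suc)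

∑δ≤1 : ∀ {s} {f : Fin s → ℕ} → Injective _≡_ _≡_ f → ∀ x → ∑[ n < s ] δ (f n) x ≤ 1
∑δ≤1 {zero}          f-inj x = z≤n
∑δ≤1 {suc s} {f = f} f-inj x with f fzero ≟ x
... | no f₀≢x rewrite ≢⇒δ≡0 f₀≢x = ∑δ≤1 (Finₚ.suc-injective ∘ f-inj) x
... | yes refl rewrite δ-refl (f fzero)
                     | sum-cong-≗ (λ n → ≢⇒δ≡0 {f (fsuc n)} (Finₚ.0≢1+n ∘ sym ∘ f-inj))
                     | sum-zero s = ≤-refl

∑δ-witness : ∀ {s} (f : Fin s → ℕ) x → 1 ≤ ∑[ n < s ] δ (f n) x → ∃ λ n → f n ≡ x
∑δ-witness {suc s} f x p with f fzero ≟ x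
... | yes f₀≡x = fzero , f₀≡x
... | no  f₀≢x rewrite ≢⇒δ≡0 f₀≢x with ∑δ-witness (f ∘ fsuc) x p
...   | n , fn≡x = fsuc n , fn≡x

occurrences : ∀ {r} → Vec ℕ r → ℕ → ℕ
occurrences []       x = 0
occurrences (y ∷ ys) x = δ y x + occurrences ys x

occurrences≡0⇒∉ : ∀ {r} (ys : Vec ℕ r) {x} → occurrences ys x ≡ 0 → All (x ≢_) ys
occurrences≡0⇒∉ []       _  = []
occurrences≡0⇒∉ (y ∷ ys) {x} eq = x≢y ∷ occurrences≡0⇒∉ ys (m+n≡0⇒n≡0 (δ y x) eq)
  where
  x≢y : x ≢ y
  x≢y refl = 0≢1+n (trans (sym (m+n≡0⇒m≡0 (δ y y) eq)) (δ-refl y))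

∑occurrences*≤ : ∀ {M r c} (F : ℕ → ℕ) → (∀ y → F y ≤ c) → (ys : Vec ℕ r) →
  ∑[ x < M ] (occurrences ys (toℕ x) * F (toℕ x)) ≤ r * c
∑occurrences*≤ {M} F F≤c [] = ≤-reflexive (sum-zero M)
∑occurrences*≤ {M} {suc r} {c} F F≤c (y ∷ ys) = begin
  ∑[ x < M ] ((δ y (toℕ x) + occurrences ys (toℕ x)) * F (toℕ x))
    ≡⟨ sum-cong-≗ {M} (λ x → *-distribʳ-+ (F (toℕ x)) (δ y (toℕ x)) _) ⟩
  ∑[ x < M ] (δ y (toℕ x) * F (toℕ x) + occurrences ys (toℕ x) * F (toℕ x))
    ≡⟨ ∑-distrib-+ {M} (λ x → δ y (toℕ x) * F (toℕ x)) _ ⟩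
  ∑[ x < M ] (δ y (toℕ x) * F (toℕ x)) + ∑[ x < M ] (occurrences ys (toℕ x) * F (toℕ x))
    ≤⟨ +-mono-≤ (≤-trans (∑δ*≤ {M} y F) (F≤c y)) (∑occurrences*≤ {M} F F≤c ys) ⟩
  c + r * c ∎
  where open ≤-Reasoning

-- Since ∸ truncates, 1 ∸ occurrences ys x is the indicator of x not occurring in ys.
∑-avoiding : ∀ {M r c} (F : ℕ → ℕ) → (∀ y → F y ≤ c) → (ys : Vec ℕ r) →
  ∑[ x < M ] F (toℕ x) ∸ r * c ≤ ∑[ x < M ] ((1 ∸ occurrences ys (toℕ x)) * F (toℕ x))
∑-avoiding {M} {r} {c} F F≤c ys = m≤n+o⇒m∸n≤o _ (r * c) (begin
  ∑[ x < M ] F (toℕ x)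
    ≤⟨ sum-mono-≤ {M} (λ x → n≤[1∸m]*n+m*n (occurrences ys (toℕ x)) (F (toℕ x))) ⟩
  ∑[ x < M ] (avoid x + hit x)
    ≡⟨ ∑-distrib-+ avoid hit ⟩
  sum avoid + sum hit
    ≤⟨ +-monoʳ-≤ (sum avoid) (∑occurrences*≤ {M} F F≤c ys) ⟩
  sum avoid + r * c
    ≡⟨ +-comm (sum avoid) (r * c) ⟩
  r * c + sum avoid ∎)
  where
  open ≤-Reasoning
  avoid hit : Fin M → ℕ
  avoid x = (1 ∸ occurrences ys (toℕ x)) * F (toℕ x)
  hit   x = occurrences ys (toℕ x) * F (toℕ x)

-- Many translates of a finite set with many common points

module CommonTranslates {s m M : ℕ} (A : Fin s → ℕ) (A-injective : Injective _≡_ _≡_ A)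
                        (g : Fin m → ℕ) (A+g<M : ∀ n i → A n + g i < M) where

  _∈A+g_ : ℕ → Fin m → Set
  x ∈A+g i = ∃ λ n → A n + g i ≡ x

  hits : Fin m → ℕ → ℕ
  hits i x = ∑[ n < s ] δ (A n + g i) x

  hits≤1 : ∀ i x → hits i x ≤ 1
  hits≤1 i x = ∑δ≤1 (λ {n} {n′} eq → A-injective (+-cancelʳ-≡ (g i) (A n) (A n′) eq)) x

  1≤hits⇒∈ : ∀ i x → 1 ≤ hits i x → x ∈A+g i
  1≤hits⇒∈ i x = ∑δ-witness (λ n → A n + g i) x

  ∑hits : ∀ i → ∑[ x < M ] hits i (toℕ x) ≡ s
  ∑hits i = begin
    ∑[ x < M ] ∑[ n < s ] δ (A n + g i) (toℕ x) ≡⟨ ∑-comm {M} {s} (λ x n → δ (A n + g i) (toℕ x)) ⟩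
    ∑[ n < s ] ∑[ x < M ] δ (A n + g i) (toℕ x) ≡⟨ sum-cong-≗ {s} (λ n → ∑δ≡1 (A n + g i) (A+g<M n i)) ⟩
    ∑[ n < s ] 1                                 ≡⟨ trans (sum-const s 1) (*-identityʳ s) ⟩
    s                                            ∎
    where open ≡-Reasoning

  popularity : (Fin m → ℕ) → ℕ → ℕ
  popularity w x = ∑[ i < m ] (w i * hits i x)

  popularity≤sum : ∀ w x → popularity w x ≤ sum w
  popularity≤sum w x = sum-mono-≤ {m} (λ i → ≤-trans (*-monoʳ-≤ (w i) (hits≤1 i x)) (≤-reflexive (*-identityʳ (w i))))

  ∑popularity : ∀ w → ∑[ x < M ] popularity w (toℕ x) ≡ sum w * s
  ∑popularity w = begin
    ∑[ x < M ] ∑[ i < m ] (w i * hits i (toℕ x)) ≡⟨ ∑-comm {M} {m} (λ x i → w i * hits i (toℕ x)) ⟩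
    ∑[ i < m ] ∑[ x < M ] (w i * hits i (toℕ x)) ≡⟨ sum-cong-≗ {m} (λ i → *-distribˡ-sum {M} (w i) (hits i ∘ toℕ)) ⟨
    ∑[ i < m ] (w i * ∑[ x < M ] hits i (toℕ x)) ≡⟨ sum-cong-≗ {m} (λ i → cong (w i *_) (∑hits i)) ⟩
    ∑[ i < m ] (w i * s)                         ≡⟨ sym (*-distribʳ-sum s w) ⟩
    sum w * s                                    ∎
    where open ≡-Reasoning

  record Stage (r : ℕ) : Set where
    field
      weight        : Fin m → ℕ
      points        : Vec ℕ r
      weight≤1      : ∀ i → weight i ≤ 1
      points-unique : Unique points
      points∈       : ∀ i → 1 ≤ weight i → All (_∈A+g i) points

  open Stage

  initial : Stage 0
  initial = record
    { weight = λ _ → 1 ; points = [] ; weight≤1 = λ _ → ≤-refl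
    ; points-unique = [] ; points∈ = λ _ _ → [] }

  -- The new point is one not yet chosen that lies in the most surviving translates;
  -- double counting shows it keeps at least a fraction (s − r)/M of them.
  extend : ∀ {r} (S : Stage r) → 1 ≤ sum (weight S) * (s ∸ r) →
           Σ (Stage (suc r)) λ S′ → sum (weight S) * (s ∸ r) ≤ M * sum (weight S′)
  extend {r} S pos = S′ , ≤-trans ∑free-large (≤-trans x-popular (≤-reflexive (cong (M *_) free-x)))
    where
    w : Fin m → ℕ
    w = weight S
    free : Fin M → ℕ
    free x = (1 ∸ occurrences (points S) (toℕ x)) * popularity w (toℕ x)
    ∑free-large : sum w * (s ∸ r) ≤ sum free
    ∑free-large = begin
      sum w * (s ∸ r)                                  ≡⟨ *-distribˡ-∸ (sum w) s r ⟩
      sum w * s ∸ sum w * r                            ≡⟨ cong₂ _∸_ (sym (∑popularity w)) (*-comm (sum w) r) ⟩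
      ∑[ x < M ] popularity w (toℕ x) ∸ r * sum w     ≤⟨ ∑-avoiding {M} (popularity w) (popularity≤sum w) (points S) ⟩
      sum free                                         ∎
      where open ≤-Reasoning
    chosen : ∃ λ x → sum free ≤ M * free x
    chosen = aboveAverage free (≤-trans pos ∑free-large)
    x : Fin M
    x = proj₁ chosen
    x-popular : sum free ≤ M * free x
    x-popular = proj₂ chosen
    x-free : occurrences (points S) (toℕ x) ≡ 0
    x-free = 1≤[1∸m]*n⇒m≡0 _ _ (1≤m*n⇒1≤n M (≤-trans pos (≤-trans ∑free-large x-popular)))
    free-x : free x ≡ popularity w (toℕ x)
    free-x = trans (cong (λ μ → (1 ∸ μ) * popularity w (toℕ x)) x-free) (*-identityˡ _)
    S′ : Stage (suc r)
    S′ = record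
      { weight        = λ i → w i * hits i (toℕ x)
      ; points        = toℕ x ∷ points S
      ; weight≤1      = λ i → *-mono-≤ (weight≤1 S i) (hits≤1 i (toℕ x))
      ; points-unique = occurrences≡0⇒∉ (points S) x-free ∷ points-unique S
      ; points∈       = λ i p → 1≤hits⇒∈ i (toℕ x) (1≤m*n⇒1≤n (w i) p) ∷ points∈ S i (1≤m*n⇒1≤m (w i) p) }

  module _ {k} (k<s : k < s) (1≤m : 1 ≤ m) where

    stage : ∀ r → r ≤ k → Σ (Stage r) λ S → m * (s ∸ k) ^ r ≤ M ^ r * sum (weight S)
    stage zero    _   = initial , ≤-reflexive (sym (trans (+-identityʳ _) (sum-const m 1)))
    stage (suc r) r<k with stage r (<⇒≤ r<k)
    ... | S , bound with extend S pos
      where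
      1≤[s∸k]^r : 1 ≤ (s ∸ k) ^ r
      1≤[s∸k]^r = m^n>0 (s ∸ k) {{>-nonZero (m<n⇒0<n∸m k<s)}} r
      pos : 1 ≤ sum (weight S) * (s ∸ r)
      pos = *-mono-≤ (1≤m*n⇒1≤n (M ^ r) (≤-trans (*-mono-≤ 1≤m 1≤[s∸k]^r) bound))
                     (m<n⇒0<n∸m (<-trans r<k k<s))
    ... | S′ , growth = S′ , (begin
      m * ((s ∸ k) * (s ∸ k) ^ r)          ≡⟨ x∙yz≈y∙xz m (s ∸ k) ((s ∸ k) ^ r) ⟩
      (s ∸ k) * (m * (s ∸ k) ^ r)          ≤⟨ *-mono-≤ (∸-monoʳ-≤ s (<⇒≤ r<k)) bound ⟩
      (s ∸ r) * (M ^ r * sum (weight S))   ≡⟨ x∙yz≈y∙zx (s ∸ r) (M ^ r) (sum (weight S)) ⟩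
      M ^ r * (sum (weight S) * (s ∸ r))   ≤⟨ *-monoʳ-≤ (M ^ r) growth ⟩
      M ^ r * (M * sum (weight S′))        ≡⟨ x∙yz≈yx∙z (M ^ r) M (sum (weight S′)) ⟩
      M * M ^ r * sum (weight S′)          ∎)
      where open ≤-Reasoning

  commonTranslates : ∀ h k → k < s → (h ∸ 1) * M ^ k < m * (s ∸ k) ^ k →
    Σ (Fin h → Fin m) λ ι → ι Preserves Fin._<_ ⟶ Fin._<_ ×
    Σ (Vec ℕ k) λ X → Unique X × (∀ t → All (_∈A+g ι t) X)
  commonTranslates h k k<s many with stage k<s (1≤m*n⇒1≤m m (≤-trans (s≤s z≤n) many)) k ≤-refl
  ... | S , bound with selectIncreasing (weight S) (weight≤1 S) h≤sum
    where
    h≤sum : h ≤ sum (weight S)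
    h≤sum = ≮⇒≥ λ sum<h → <-irrefl refl (<-≤-trans many (begin
      m * (s ∸ k) ^ k        ≤⟨ bound ⟩
      M ^ k * sum (weight S) ≤⟨ *-monoʳ-≤ (M ^ k) (subst (sum (weight S) ≤_) (pred[m∸n]≡m∸[1+n] h 0) (<⇒≤pred sum<h)) ⟩
      M ^ k * (h ∸ 1)        ≡⟨ *-comm (M ^ k) (h ∸ 1) ⟩
      (h ∸ 1) * M ^ k        ∎))
      where open ≤-Reasoning
  ... | ι , ι-mono , ι-alive =
    ι , ι-mono , points S , points-unique S , λ t → points∈ S (ι t) (ι-alive t)

-- Dyadic scales at which A is dense

infixl 7 _÷_

_÷_ : ℕ → (q : ℕ) → .{{NonZero q}} → ℚᵘ
p ÷ q = ℤ.+ p /ᵘ q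

÷-mono-≤ : ∀ {p q r t} .{{_ : NonZero q}} .{{_ : NonZero t}} → p * t ≤ r * q → p ÷ q ≤ᵘ r ÷ t
÷-mono-≤ {p} {suc q} {r} {suc t} le = *≤* (subst₂ ℤ._≤_ (ℤₚ.pos-* p (suc t)) (ℤₚ.pos-* r (suc q)) (+≤+ le))

÷-cancel-≤ : ∀ {p q r t} .{{_ : NonZero q}} .{{_ : NonZero t}} → p ÷ q ≤ᵘ r ÷ t → p * t ≤ r * q
÷-cancel-≤ {p} {suc q} {r} {suc t} (*≤* le) =
  ℤₚ.drop‿+≤+ (subst₂ ℤ._≤_ (sym (ℤₚ.pos-* p (suc t))) (sym (ℤₚ.pos-* r (suc q))) le)

÷-+-≤ : ∀ {p q r t u v} .{{_ : NonZero q}} .{{_ : NonZero t}} .{{_ : NonZero v}} →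
        (p * t + r * q) * v ≤ u * (q * t) → p ÷ q +ᵘ r ÷ t ≤ᵘ u ÷ v
÷-+-≤ {p} {suc q} {r} {suc t} {u} {suc v} le =
  *≤* (subst₂ ℤ._≤_ numerators (ℤₚ.pos-* u (suc q * suc t)) (+≤+ le))
  where
  numerators : ℤ.+ ((p * suc t + r * suc q) * suc v)
             ≡ (ℤ.+ p ℤ.* ℤ.+ suc t ℤ.+ ℤ.+ r ℤ.* ℤ.+ suc q) ℤ.* ℤ.+ suc v
  numerators = trans (ℤₚ.pos-* (p * suc t + r * suc q) (suc v)) (cong (ℤ._* ℤ.+ suc v)
    (trans (ℤₚ.pos-+ (p * suc t) (r * suc q)) (cong₂ ℤ._+_ (ℤₚ.pos-* p (suc t)) (ℤₚ.pos-* r (suc q)))))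

x≤ᵘx+y : ∀ x {y} → 0ᵘ ≤ᵘ y → x ≤ᵘ x +ᵘ y
x≤ᵘx+y x 0≤y =
  ℚᵘₚ.≤-trans (ℚᵘₚ.≤-reflexive (ℚᵘₚ.≃-sym (ℚᵘₚ.+-identityʳ x))) (ℚᵘₚ.+-monoʳ-≤ x 0≤y)

toℚᵘ-recip : ∀ x → toℚᵘ (recip (suc x)) ≃ᵘ 1 ÷ suc x
toℚᵘ-recip x = ℚₚ.toℚᵘ-fromℚᵘ (1 ÷ suc x)

toℚᵘ-recip≤ : ∀ {d x} .{{_ : NonZero d}} → d ≤ x → toℚᵘ (recip x) ≤ᵘ 1 ÷ d
toℚᵘ-recip≤ {suc d} {suc x} d≤x =
  ℚᵘₚ.≤-trans (ℚᵘₚ.≤-reflexive (toℚᵘ-recip x)) (÷-mono-≤ (*-monoʳ-≤ 1 d≤x))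

0≤toℚᵘ-recip : ∀ x → 0ᵘ ≤ᵘ toℚᵘ (recip x)
0≤toℚᵘ-recip zero    = ℚᵘₚ.≤-refl
0≤toℚᵘ-recip (suc x) = ℚᵘₚ.≤-trans (÷-mono-≤ z≤n) (ℚᵘₚ.≤-reflexive (ℚᵘₚ.≃-sym (toℚᵘ-recip x)))

Dense : (ℕ → ℕ) → ℕ → Set
Dense a j = a (2 ^ j) < 2 ^ j * (suc j * suc (suc j))

dense? : ∀ a j → Dec (Dense a j)
dense? a j = a (2 ^ j) <? 2 ^ j * (suc j * suc (suc j))

module DyadicDensity (a : ℕ → ℕ) (a-inc : IncEnum a) where

  S : ℕ → ℚᵘ
  S N = toℚᵘ (partialRecipSum a N)

  S-suc : ∀ N → S (suc N) ≃ᵘ S N +ᵘ toℚᵘ (recip (a N))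
  S-suc N = ℚₚ.toℚᵘ-homo-+ (partialRecipSum a N) (recip (a N))

  S-step : ∀ N → S N ≤ᵘ S (suc N)
  S-step N = ℚᵘₚ.≤-trans (x≤ᵘx+y (S N) (0≤toℚᵘ-recip (a N))) (ℚᵘₚ.≤-reflexive (ℚᵘₚ.≃-sym (S-suc N)))

  S-mono : ∀ {N N′} → N ≤ N′ → S N ≤ᵘ S N′
  S-mono = mono′ ∘ ≤⇒≤′
    where
    mono′ : ∀ {N N′} → N ≤′ N′ → S N ≤ᵘ S N′
    mono′ ≤′-refl          = ℚᵘₚ.≤-refl
    mono′ (≤′-step {n} N≤′n) = ℚᵘₚ.≤-trans (mono′ N≤′n) (S-step n)

  S-block : ∀ B d .{{_ : NonZero d}} → (∀ n → B ≤ n → d ≤ a n) → ∀ r → S (B + r) ≤ᵘ S B +ᵘ r ÷ d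
  S-block B d d≤a zero rewrite +-identityʳ B = x≤ᵘx+y (S B) (÷-mono-≤ z≤n)
  S-block B d d≤a (suc r) rewrite +-suc B r = begin
    S (suc (B + r))
      ≃⟨ S-suc (B + r) ⟩
    S (B + r) +ᵘ toℚᵘ (recip (a (B + r)))
      ≤⟨ ℚᵘₚ.+-mono-≤ (S-block B d d≤a r) (toℚᵘ-recip≤ (d≤a (B + r) (m≤m+n B r))) ⟩
    (S B +ᵘ r ÷ d) +ᵘ 1 ÷ d
      ≡⟨ ℚᵘₚ.+-assoc-≡ (S B) (r ÷ d) (1 ÷ d) ⟩
    S B +ᵘ (r ÷ d +ᵘ 1 ÷ d)
      ≤⟨ ℚᵘₚ.+-monoʳ-≤ (S B) (÷-+-≤ (≤-reflexive (common-denominator r d))) ⟩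
    S B +ᵘ suc r ÷ d ∎
    where
    open ℚᵘₚ.≤-Reasoning
    common-denominator : ∀ r d → (r * d + 1 * d) * d ≡ suc r * (d * d)
    common-denominator = solve-∀

  S≤N : ∀ N → S N ≤ᵘ N ÷ 1
  S≤N N = ℚᵘₚ.≤-trans (S-block 0 1 (λ n _ → ≤-trans (s≤s z≤n) (n<enum a-inc n)) N)
                      (ℚᵘₚ.≤-reflexive (ℚᵘₚ.+-identityˡ (N ÷ 1)))

  -- Across a scale J where A is sparse the block [2^J, 2^{J+1}) adds at most
  -- 1/((J+1)(J+2)) = 1/(J+1) − 1/(J+2) to S, so Φ does not increase.
  Φ : ℕ → ℚᵘ
  Φ J = S (2 ^ J) +ᵘ 1 ÷ suc J

  Φ-step : ∀ J → ¬ Dense a J → Φ (suc J) ≤ᵘ Φ J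
  Φ-step J sparse = begin
    S (B + (B + 0)) +ᵘ 1 ÷ suc (suc J)
      ≡⟨ cong (λ n → S (B + n) +ᵘ 1 ÷ suc (suc J)) (+-identityʳ B) ⟩
    S (B + B) +ᵘ 1 ÷ suc (suc J)
      ≤⟨ ℚᵘₚ.+-monoˡ-≤ (1 ÷ suc (suc J)) (S-block B T T≤a B) ⟩
    (S B +ᵘ B ÷ T) +ᵘ 1 ÷ suc (suc J)
      ≡⟨ ℚᵘₚ.+-assoc-≡ (S B) (B ÷ T) (1 ÷ suc (suc J)) ⟩
    S B +ᵘ (B ÷ T +ᵘ 1 ÷ suc (suc J))
      ≤⟨ ℚᵘₚ.+-monoʳ-≤ (S B) (÷-+-≤ {B} {T} {1} {suc (suc J)} (≤-reflexive (telescoping B J))) ⟩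
    S B +ᵘ 1 ÷ suc J ∎
    where
    open ℚᵘₚ.≤-Reasoning
    B T : ℕ
    B = 2 ^ J
    T = B * (suc J * suc (suc J))
    instance
      T≢0 : NonZero T
      T≢0 = m*n≢0 (2 ^ J) _ {{m^n≢0 2 J}}
    T≤a : ∀ n → B ≤ n → T ≤ a n
    T≤a n B≤n = ≤-trans (≮⇒≥ sparse) (<-step⇒≤-mono (proj₂ a-inc) B≤n)
    telescoping : ∀ e J → (e * suc (suc J) + 1 * (e * (suc J * suc (suc J)))) * suc J
                        ≡ 1 * (e * (suc J * suc (suc J)) * suc (suc J))
    telescoping = solve-∀

  Φ-antitone : ∀ j₀ r → (∀ i → i < r → ¬ Dense a (j₀ + i)) → Φ (j₀ + r) ≤ᵘ Φ j₀
  Φ-antitone j₀ zero    _      rewrite +-identityʳ j₀ = ℚᵘₚ.≤-refl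
  Φ-antitone j₀ (suc r) sparse rewrite +-suc j₀ r =
    ℚᵘₚ.≤-trans (Φ-step (j₀ + r) (sparse r ≤-refl)) (Φ-antitone j₀ r (λ i i<r → sparse i (m<n⇒m<1+n i<r)))

  Φ≤ : ∀ J → Φ J ≤ᵘ (2 ^ J + 1) ÷ 1
  Φ≤ J = ℚᵘₚ.≤-trans (ℚᵘₚ.+-mono-≤ (S≤N (2 ^ J)) (÷-mono-≤ {1} {suc J} {1} {1} (s≤s z≤n)))
                     (÷-+-≤ {2 ^ J} {1} {1} {1} (≤-reflexive (unit-denominators (2 ^ J))))
    where
    unit-denominators : ∀ e → (e * 1 + 1 * 1) * 1 ≡ (e + 1) * (1 * 1)
    unit-denominators = solve-∀

  denseScale : RecipSumDiverges a → ∀ j₀ → ∃ λ j → j₀ ≤ j × Dense a j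
  denseScale diverges j₀ with diverges (fromℚᵘ ((2 ^ j₀ + 2) ÷ 1))
  ... | N , large with Finₚ.any? {n = N} (λ i → dense? a (j₀ + toℕ i))
  ... | yes (i , dense) = j₀ + toℕ i , m≤m+n j₀ (toℕ i) , dense
  ... | no  none        = contradiction (÷-cancel-≤ bounded) (<⇒≱ (*-monoˡ-< 1 (+-monoʳ-< (2 ^ j₀) ≤-refl)))
    where
    open ℚᵘₚ.≤-Reasoning
    sparse : ∀ i → i < N → ¬ Dense a (j₀ + i)
    sparse i i<N dense = none (Fin.fromℕ< i<N , subst (λ i → Dense a (j₀ + i)) (sym (Finₚ.toℕ-fromℕ< i<N)) dense)
    bounded : (2 ^ j₀ + 2) ÷ 1 ≤ᵘ (2 ^ j₀ + 1) ÷ 1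
    bounded = begin
      (2 ^ j₀ + 2) ÷ 1                    ≃⟨ ℚᵘₚ.≃-sym (ℚₚ.toℚᵘ-fromℚᵘ ((2 ^ j₀ + 2) ÷ 1)) ⟩
      toℚᵘ (fromℚᵘ ((2 ^ j₀ + 2) ÷ 1))    ≤⟨ ℚₚ.toℚᵘ-mono-≤ large ⟩
      S N                                 ≤⟨ S-mono (<⇒≤ (<-≤-trans (n<2^n N) (^-monoʳ-≤ 2 (m≤n+m N j₀)))) ⟩
      S (2 ^ (j₀ + N))                    ≤⟨ x≤ᵘx+y (S (2 ^ (j₀ + N))) (÷-mono-≤ z≤n) ⟩
      Φ (j₀ + N)                          ≤⟨ Φ-antitone j₀ N sparse ⟩
      Φ j₀                                ≤⟨ Φ≤ j₀ ⟩
      (2 ^ j₀ + 1) ÷ 1                    ∎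

-- From common translates to the required tuples

⊆shifts⇒ManyReps : ∀ a {k} c d {X : Vec ℕ k} → Unique X → c ≤ d →
  All (λ x → ∃ λ n → a n + c ≡ x) X → All (λ x → ∃ λ n → a n + d ≡ x) X → ManyReps a k (d ∸ c)
⊆shifts⇒ManyReps a {k} c d {X} X-unique c≤d X⊆a+c X⊆a+d = f , f-injective , f-reps
  where
  f : Fin k → ℕ
  f u = lookup X u ∸ c
  c≤X : ∀ u → c ≤ lookup X u
  c≤X u with lookup⁺ X⊆a+c u
  ... | n , eq = subst (c ≤_) eq (m≤n+m c (a n))
  f-injective : Injective _≡_ _≡_ f
  f-injective {u} {u′} eq = lookup-injective X-unique u u′ (∸-cancelʳ-≡ (c≤X u) (c≤X u′) eq)
  f-reps : ∀ u → f u ∈ₛ a × ∃ λ y → y ∈ₛ a × f u ≡ y + (d ∸ c)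
  f-reps u with lookup X u | lookup⁺ X⊆a+c u | lookup⁺ X⊆a+d u
  ... | _ | n , refl | n′ , eq =
    (n , sym (m+n∸n≡m (a n) c)) , a n′ , (n′ , refl) , trans (cong (_∸ c) (sym eq)) (+-∸-assoc (a n′) c≤d)

GoodTuple : (a b : ℕ → ℕ) (k : ℕ) {h : ℕ} → Vec ℕ h → Set
GoodTuple a b k {h} β =
  ((t u : Fin h) → t Fin.< u → lookup β t < lookup β u) ×
  ((t : Fin h) → lookup β t ∈ₛ b) ×
  ((t u : Fin h) → t Fin.< u → ManyReps a k (lookup β u ∸ lookup β t))

tabulate-GoodTuple : ∀ a b → IncEnum b → ∀ {h k m m₀} (ι : Fin h → Fin m) → ι Preserves Fin._<_ ⟶ Fin._<_ →
  {X : Vec ℕ k} → Unique X → (∀ t → All (λ x → ∃ λ n → a n + b (m₀ + toℕ (ι t)) ≡ x) X) →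
  Σ (Vec ℕ h) λ β → GoodTuple a b k β × ((t : Fin h) → m₀ < lookup β t)
tabulate-GoodTuple a b b-inc {h} {k} {m} {m₀} ι ι-mono {X} X-unique X⊆a+g =
  β , (increasing , members , reps) , beyond
  where
  g : Fin m → ℕ
  g i = b (m₀ + toℕ i)
  g∘ι-mono : ∀ {t u} → t Fin.< u → g (ι t) < g (ι u)
  g∘ι-mono t<u = <-step⇒<-mono (proj₂ b-inc) (+-monoʳ-< m₀ (ι-mono t<u))
  β : Vec ℕ h
  β = tabulate (g ∘ ι)
  β≡ : ∀ t → lookup β t ≡ g (ι t)
  β≡ = lookup∘tabulate (g ∘ ι)
  increasing : (t u : Fin h) → t Fin.< u → lookup β t < lookup β u
  increasing t u t<u = subst₂ _<_ (sym (β≡ t)) (sym (β≡ u)) (g∘ι-mono t<u)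
  members : (t : Fin h) → lookup β t ∈ₛ b
  members t = m₀ + toℕ (ι t) , sym (β≡ t)
  reps : (t u : Fin h) → t Fin.< u → ManyReps a k (lookup β u ∸ lookup β t)
  reps t u t<u = subst₂ (λ x y → ManyReps a k (y ∸ x)) (sym (β≡ t)) (sym (β≡ u))
    (⊆shifts⇒ManyReps a (g (ι t)) (g (ι u)) X-unique (<⇒≤ (g∘ι-mono t<u)) (X⊆a+g t) (X⊆a+g u))
  beyond : (t : Fin h) → m₀ < lookup β t
  beyond t = subst (m₀ <_) (sym (β≡ t)) (≤-<-trans (m≤m+n m₀ (toℕ (ι t))) (n<enum b-inc (m₀ + toℕ (ι t))))

headBound : ∀ {n} → List (Vec ℕ (suc n)) → ℕ
headBound L = max 0 (List.map head L)

∉-if-beyond-headBound : ∀ {n} (L : List (Vec ℕ (suc n))) (β : Vec ℕ (suc n)) →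
                        headBound L < lookup β fzero → β ∉ L
∉-if-beyond-headBound L β@(_ ∷ _) beyond β∈L =
  <⇒≱ beyond (ListAll.lookup (ListAllₚ.map⁻ (xs≤max 0 (List.map head L))) β∈L)

-- Choice of the parameters

ratio : ℕ → ℕ
ratio j = 8 * (j * j)

1≤ratio : ∀ {j} → 1 ≤ j → 1 ≤ ratio j
1≤ratio 1≤j = ≤-trans (m≤n*m 1 8) (*-monoʳ-≤ 8 (*-mono-≤ 1≤j 1≤j))

s≤2*[s∸k] : ∀ {s k} → 2 * k ≤ s → s ≤ 2 * (s ∸ k)
s≤2*[s∸k] {s} {k} 2k≤s = begin
  s                  ≡⟨ m∸n+n≡m k≤s ⟨
  (s ∸ k) + k        ≤⟨ +-monoʳ-≤ (s ∸ k) (m+n≤o⇒m≤o∸n k (subst (_≤ s) (cong (k +_) (+-identityʳ k)) 2k≤s)) ⟩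
  (s ∸ k) + (s ∸ k)  ≡⟨ cong ((s ∸ k) +_) (+-identityʳ (s ∸ k)) ⟨
  2 * (s ∸ k)        ∎
  where
  open ≤-Reasoning
  k≤s : k ≤ s
  k≤s = ≤-trans (m≤m+n k (k + 0)) 2k≤s

[1+j][2+j]<4j² : ∀ {j} → 2 ≤ j → suc j * suc (suc j) < 4 * (j * j)
[1+j][2+j]<4j² {suc zero}    (s≤s ())
[1+j][2+j]<4j² {suc (suc t)} _ = ≤-trans (m≤m+n _ (3 * (t * t) + 9 * t + 3)) (≤-reflexive (expand t))
  where
  expand : ∀ t → suc ((3 + t) * (4 + t)) + (3 * (t * t) + 9 * t + 3) ≡ 4 * ((2 + t) * (2 + t))
  expand = solve-∀

x+s≤ratio*[s∸k] : ∀ {x s j k} → 2 ≤ j → 2 * k ≤ s → x < s * (suc j * suc (suc j)) → x + s ≤ ratio j * (s ∸ k)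
x+s≤ratio*[s∸k] {x} {s} {j} {k} 2≤j 2k≤s x< = begin
  x + s                         ≤⟨ +-monoˡ-≤ s (<⇒≤ x<) ⟩
  s * P + s                     ≡⟨ trans (*-suc s P) (+-comm s (s * P)) ⟨
  s * suc P                     ≤⟨ *-monoʳ-≤ s ([1+j][2+j]<4j² 2≤j) ⟩
  s * (4 * (j * j))             ≤⟨ *-monoˡ-≤ (4 * (j * j)) (s≤2*[s∸k] {s} {k} 2k≤s) ⟩
  2 * (s ∸ k) * (4 * (j * j))   ≡⟨ regroup (s ∸ k) j ⟩
  ratio j * (s ∸ k)             ∎
  where
  open ≤-Reasoning
  P = suc j * suc (suc j)
  regroup : ∀ t j → 2 * t * (4 * (j * j)) ≡ 8 * (j * j) * t
  regroup = solve-∀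

pred[h]*M^k< : ∀ {h M c t} k → 1 ≤ h → 1 ≤ c * t → M ≤ c * t → (h ∸ 1) * M ^ k < h * c ^ k * t ^ k
pred[h]*M^k< {suc h} {M} {c} {t} k _ 1≤ct M≤ct = begin-strict
  h * M ^ k                ≤⟨ *-monoʳ-≤ h (^-monoˡ-≤ k M≤ct) ⟩
  h * (c * t) ^ k          <⟨ m<n+m (h * (c * t) ^ k) (m^n>0 (c * t) {{>-nonZero 1≤ct}} k) ⟩
  suc h * (c * t) ^ k      ≡⟨ cong (suc h *_) (^-distribʳ-* c t k) ⟩
  suc h * (c ^ k * t ^ k)  ≡⟨ *-assoc (suc h) (c ^ k) (t ^ k) ⟨
  suc h * c ^ k * t ^ k    ∎
  where open ≤-Reasoning

j≤h*ratio[j]^k : ∀ {h k} j → 1 ≤ h → 1 ≤ k → j ≤ h * ratio j ^ k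
j≤h*ratio[j]^k {suc h} {suc k} j _ _ = begin
  j                        ≤⟨ j≤ratio j ⟩
  ratio j                  ≤⟨ m≤m^[1+n] (ratio j) k ⟩
  ratio j ^ suc k          ≤⟨ m≤n*m (ratio j ^ suc k) (suc h) ⟩
  suc h * ratio j ^ suc k  ∎
  where
  open ≤-Reasoning
  j≤ratio : ∀ j → j ≤ ratio j
  j≤ratio zero      = z≤n
  j≤ratio j@(suc _) = ≤-trans (m≤m*n j j) (m≤n*m (j * j) 8)

1+m₀+h*X<2*[1+h+m₀]*X : ∀ h m₀ {X} → 1 ≤ X → suc (m₀ + h * X) < 2 * suc (h + m₀) * X
1+m₀+h*X<2*[1+h+m₀]*X h m₀ {suc x} _ =
  ≤-trans (m≤m+n _ (2 * x + h + h * x + m₀ + 2 * m₀ * x)) (≤-reflexive (expand h m₀ x))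
  where
  expand : ∀ h m₀ x → suc (suc (m₀ + h * suc x)) + (2 * x + h + h * x + m₀ + 2 * m₀ * x)
                    ≡ 2 * suc (h + m₀) * suc x
  expand = solve-∀

index-bound : ∀ h m₀ {j k} → 1 ≤ j → 1 ≤ k →
              suc (m₀ + h * ratio j ^ k) < (4 * suc (h + m₀) * j) ^ (2 * k)
index-bound h m₀ {j} {suc k} 1≤j _ = begin-strict
  suc (m₀ + h * X)                  <⟨ 1+m₀+h*X<2*[1+h+m₀]*X h m₀ 1≤X ⟩
  2 * W * X                         ≤⟨ *-monoˡ-≤ X (≤-trans (m≤m*n (2 * W) W) (m≤m^[1+n] (2 * W * W) k)) ⟩
  (2 * W * W) ^ suc k * X           ≡⟨ ^-distribʳ-* (2 * W * W) (ratio j) (suc k) ⟨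
  (2 * W * W * ratio j) ^ suc k     ≡⟨ cong (_^ suc k) (square W j) ⟩
  ((4 * W * j) ^ 2) ^ suc k         ≡⟨ ^-*-assoc (4 * W * j) 2 (suc k) ⟩
  (4 * W * j) ^ (2 * suc k)         ∎
  where
  open ≤-Reasoning
  W X : ℕ
  W = suc (h + m₀)
  X = ratio j ^ suc k
  1≤X : 1 ≤ X
  1≤X = m^n>0 (ratio j) {{>-nonZero (1≤ratio 1≤j)}} (suc k)
  square : ∀ w j → 2 * w * w * (8 * (j * j)) ≡ 4 * w * j * (4 * w * j * 1)
  square = solve-∀

below-2^ : ∀ {c x n j} q → (c * ⌊log₂ x ⌋) ^ q ≤ n → n < (c * j) ^ q → x < 2 ^ j
below-2^ {c} {x} {n} {j} q small n< = ≰⇒> λ 2^j≤x →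
  <⇒≱ n< (≤-trans (^-monoˡ-≤ q (*-monoʳ-≤ c (j≤⌊log₂x⌋ 2^j≤x))) small)
  where
  j≤⌊log₂x⌋ : 2 ^ j ≤ x → j ≤ ⌊log₂ x ⌋
  j≤⌊log₂x⌋ 2^j≤x = subst (_≤ ⌊log₂ x ⌋) (⌊log₂[2^n]⌋≡n j) (⌊log₂⌋-mono-≤ 2^j≤x)

module Construction (a b : ℕ → ℕ) (a-inc : IncEnum a) (b-inc : IncEnum b)
                    {h k m₀ j : ℕ} (1≤h : 1 ≤ h) (1≤k : 1 ≤ k) (2≤j : 2 ≤ j) (2k≤j : 2 * k ≤ j)
                    (dense : Dense a j) (b-small : b (m₀ + h * ratio j ^ k) < 2 ^ j) where

  s M m : ℕ
  s = 2 ^ j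
  M = a s + s
  m = h * ratio j ^ k

  A : Fin s → ℕ
  A n = a (toℕ n)

  g : Fin m → ℕ
  g i = b (m₀ + toℕ i)

  a-mono : ∀ {n n′} → n < n′ → a n < a n′
  a-mono = <-step⇒<-mono (proj₂ a-inc)

  A-injective : Injective _≡_ _≡_ A
  A-injective {n} {n′} eq with <-cmp (toℕ n) (toℕ n′)
  ... | tri< n<n′ _ _ = contradiction eq (<⇒≢ (a-mono n<n′))
  ... | tri≈ _ n≡n′ _ = Finₚ.toℕ-injective n≡n′
  ... | tri> _ _ n>n′ = contradiction eq (≢-sym (<⇒≢ (a-mono n>n′)))

  A+g<M : ∀ n i → A n + g i < M
  A+g<M n i = +-mono-< (a-mono (Finₚ.toℕ<n n))
                       (<-trans (<-step⇒<-mono (proj₂ b-inc) (+-monoʳ-< m₀ (Finₚ.toℕ<n i))) b-small)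

  2k≤s : 2 * k ≤ s
  2k≤s = ≤-trans 2k≤j (<⇒≤ (n<2^n j))

  k<s : k < s
  k<s = <-≤-trans (m<m+n k (≤-trans 1≤k (m≤m+n k 0))) 2k≤s

  many : (h ∸ 1) * M ^ k < m * (s ∸ k) ^ k
  many = pred[h]*M^k< k 1≤h (*-mono-≤ (1≤ratio (≤-trans (s≤s z≤n) 2≤j)) (m<n⇒0<n∸m k<s))
                            (x+s≤ratio*[s∸k] {k = k} 2≤j 2k≤s dense)

  open CommonTranslates A A-injective g A+g<M using (commonTranslates)

  tuple : Σ (Vec ℕ h) λ β → GoodTuple a b k β × ((t : Fin h) → m₀ < lookup β t)
  tuple =
    let (ι , ι-mono , X , X-unique , X⊆A+g) = commonTranslates h k k<s many
    in tabulate-GoodTuple a b b-inc ι ι-mono X-unique (λ t → All.map (λ (n , eq) → toℕ n , eq) (X⊆A+g t))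

corollary2p5 : (a b : ℕ → ℕ) → IncEnum a → IncEnum b →
    RecipSumDiverges a → LogSubPoly b →
    (h k : ℕ) → 2 ≤ h → 1 ≤ k →
    (L : List (Vec ℕ h)) →
      Σ (Vec ℕ h) λ β →
        ((i j : Fin h) → i Fin.< j → lookup β i < lookup β j) ×
        ((i : Fin h) → lookup β i ∈ₛ b) ×
        ((i j : Fin h) → i Fin.< j → ManyReps a k (lookup β j ∸ lookup β i)) ×
        β ∉ L
corollary2p5 a b a-inc b-inc diverges log-small (suc h) k _ 1≤k L =
  let m₀ = headBound L
      -- q = 2k and c = 4(h + m₀ + 1) make (c j)^q exceed every index used (index-bound).
      (N₀ , eventually) = log-small (2 * k) (4 * suc (suc h + m₀)) (≤-trans 1≤k (m≤m+n k (k + 0))) (s≤s z≤n)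
      (j , j₀≤j , dense) = DyadicDensity.denseScale a a-inc diverges (N₀ + 2 * k + 2)
      2≤j  = ≤-trans (m≤n+m 2 (N₀ + 2 * k)) j₀≤j
      2k≤j = ≤-trans (≤-trans (m≤n+m (2 * k) N₀) (m≤m+n _ 2)) j₀≤j
      N₀≤j = ≤-trans (≤-trans (m≤m+n N₀ (2 * k)) (m≤m+n _ 2)) j₀≤j
      index = m₀ + suc h * ratio j ^ k
      N₀≤index = ≤-trans N₀≤j (≤-trans (j≤h*ratio[j]^k {suc h} j (s≤s z≤n) 1≤k) (m≤n+m _ m₀))
      b-small = below-2^ {c = 4 * suc (suc h + m₀)} {j = j} (2 * k) (eventually index N₀≤index)
                         (index-bound (suc h) m₀ (≤-trans (s≤s z≤n) 2≤j) 1≤k)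
      (β , (increasing , members , reps) , beyond) =
        Construction.tuple a b a-inc b-inc (s≤s z≤n) 1≤k 2≤j 2k≤j dense b-small
  in β , increasing , members , reps , ∉-if-beyond-headBound L β (beyond fzero)
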